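{- Let $G$ be a (finite, simple) plane graph with minimum degree five having no vertices of degree from $7$ to $11$. Then $G$ contains at least one of the following minor $5$-stars: a $\langle 5,6,6,5,\infty\rangle$-star, a $\langle 5,6,6,6,17\rangle$-star, a $\langle 6,6,6,6,6\rangle$-star.
   Context: A plane graph is a graph embedded in the plane without edge crossings; $\deg(v)$ denotes the degree of $v$ in $G$. For integers (or $\infty$) $\kappa_1,\dots,\kappa_5$, a $\langle \kappa_1,\kappa_2,\kappa_3,\kappa_4,\kappa_5\rangle$-star in $G$ is a vertex $v$ of degree exactly $5$ together with its five neighbors $v_1,\dots,v_5$, listed in the cyclic order around $v$ given by the embedding (starting at some neighbor, in either orientation), such that $\deg(v_i)\le \kappa_i$ for $i=1,\dots,5$; the entry $\infty$ means no restriction. A minor $5$-star is a $5$-vertex together with its five neighbors. -}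

module Defs where

open import Data.Nat using (ℕ; zero; suc; _+_; _*_; _≤_; _∸_)
open import Data.Nat.Properties using (_≤?_)
open import Data.Fin using (Fin; toℕ)
open import Data.Fin.Properties using (any?; all?; _≟_)
open import Data.List using (List; length; filter; allFin)
open import Data.Maybe using (Maybe; just; nothing)
open import Data.Product using (Σ; _×_; _,_)
open import Data.Sum using (_⊎_)
open import Data.Unit using (⊤)
open import Relation.Nullary using (¬_; Dec; yes; no)
open import Relation.Nullary.Decidable using (_→-dec_; _⊎-dec_)
open import Relation.Binary.PropositionalEquality using (_≡_; _≢_)

iter : {A : Set} → (A → A) → ℕ → A → A
iter f zero    x = x
iter f (suc k) x = f (iter f k x)

count : (n : ℕ) {P : Fin n → Set} → ((i : Fin n) → Dec (P i)) → ℕ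
count n P? = length (filter P? (allFin n))

-- A (finite, simple) plane graph without isolated vertices is encoded,
-- as usual, by its darts (= half-edges, two per edge), the fixed-point
-- free involution α pairing the two darts of an edge, and the rotation
-- permutation σ sending a dart at v to the next dart at v in the cyclic
-- (say counterclockwise) order given by the embedding.  Vertices are the
-- σ-orbits, edges the α-orbits, faces the (σ∘α)-orbits.  Planarity of
-- the embedding is the Euler condition V - E + F = 2 on every connected
-- component, i.e. V - E + F = 2C (each component has V-E+F ≤ 2).

record Map : Set where
  field
    nd      : ℕ
    α       : Fin nd → Fin nd
    σ       : Fin nd → Fin nd
    σ⁻¹     : Fin nd → Fin nd
    α-invol : ∀ d → α (α d) ≡ d
    α-nofix : ∀ d → α d ≢ d
    σ-inv₁  : ∀ d → σ (σ⁻¹ d) ≡ d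
    σ-inv₂  : ∀ d → σ⁻¹ (σ d) ≡ d

module _ (M : Map) where
  open Map M

  -- e lies in the f-orbit of d (an orbit of a permutation of nd points
  -- is reached within fewer than nd steps)
  SameOrbit : (Fin nd → Fin nd) → Fin nd → Fin nd → Set
  SameOrbit f d e = Σ (Fin nd) λ k → iter f (toℕ k) d ≡ e

  sameOrbit? : (f : Fin nd → Fin nd) → ∀ d e → Dec (SameOrbit f d e)
  sameOrbit? f d e = any? (λ k → iter f (toℕ k) d ≟ e)

  OrbitRep : (Fin nd → Fin nd) → Fin nd → Set
  OrbitRep f d = ∀ e → SameOrbit f d e → toℕ d ≤ toℕ e

  orbitRep? : (f : Fin nd → Fin nd) → ∀ d → Dec (OrbitRep f d)
  orbitRep? f d = all? (λ e → sameOrbit? f d e →-dec (toℕ d ≤? toℕ e))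

  numOrbits : (Fin nd → Fin nd) → ℕ
  numOrbits f = count nd (orbitRep? f)

  φ : Fin nd → Fin nd
  φ d = σ (α d)

  numV numF : ℕ
  numV = numOrbits σ
  numF = numOrbits φ

  Reach : ℕ → Fin nd → Fin nd → Set
  Reach zero    d e = d ≡ e
  Reach (suc k) d e = Reach k d e ⊎ (Reach k (σ d) e ⊎ Reach k (α d) e)

  reach? : ∀ k d e → Dec (Reach k d e)
  reach? zero    d e = d ≟ e
  reach? (suc k) d e = reach? k d e ⊎-dec (reach? k (σ d) e ⊎-dec reach? k (α d) e)

  CompRep : Fin nd → Set
  CompRep d = ∀ e → Reach nd d e → toℕ d ≤ toℕ e

  compRep? : ∀ d → Dec (CompRep d)
  compRep? d = all? (λ e → reach? nd d e →-dec (toℕ d ≤? toℕ e))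

  numC : ℕ
  numC = count nd compRep?

  -- Euler's formula V - E + F = 2C, with E = nd / 2, multiplied by 2
  IsPlanar : Set
  IsPlanar = 2 * (numV + numF) ≡ nd + 4 * numC

  -- simple: no loops and no multiple edges
  IsSimple : Set
  IsSimple = (∀ d → ¬ SameOrbit σ d (α d))
           × (∀ d e → SameOrbit σ d e → SameOrbit σ (α d) (α e) → d ≡ e)

  deg : Fin nd → ℕ
  deg d = count nd (sameOrbit? σ d)

  -- degree bound, nothing = ∞ (no restriction)
  _≤κ_ : ℕ → Maybe ℕ → Set
  n ≤κ nothing = ⊤
  n ≤κ just k  = n ≤ k

  nbdeg : Fin nd → ℕ → ℕ
  nbdeg d i = deg (α (iter σ i d))

  -- ⟨κ₁,…,κ₅⟩-star centred at the vertex of dart d, the neighbours being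
  -- listed starting at the head of d, in either orientation
  Star : Maybe ℕ → Maybe ℕ → Maybe ℕ → Maybe ℕ → Maybe ℕ → Fin nd → Set
  Star κ₁ κ₂ κ₃ κ₄ κ₅ d =
    deg d ≡ 5 ×
    ( (nbdeg d 0 ≤κ κ₁ × nbdeg d 1 ≤κ κ₂ × nbdeg d 2 ≤κ κ₃ × nbdeg d 3 ≤κ κ₄ × nbdeg d 4 ≤κ κ₅)
    ⊎ (nbdeg d 0 ≤κ κ₁ × nbdeg d 4 ≤κ κ₂ × nbdeg d 3 ≤κ κ₃ × nbdeg d 2 ≤κ κ₄ × nbdeg d 1 ≤κ κ₅))

module Submission where

-- Discharging, with all charges scaled by 12. Give every dart 12 at its vertex and 24 at its face, and take
-- 72 from every vertex and every face: the vertex v then holds 12 (deg v − 6), the face f holds 12 (2|f| − 6),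
-- and Euler's formula V − E + F = 2C makes the total −144 C. Rules: each face of size at least 4 gives 6 to
-- each of its corners; a 5-vertex with a big neighbour u (degree ≥ 12) gets from u, for each triangle on the
-- edge to u, 6 if u is its only big neighbour and 3 otherwise. Without the three stars every face and vertex
-- ends with nonnegative charge, so C = 0. Faces are immediate. A 5-vertex has a big neighbour (else it
-- centres a ⟨6,6,6,6,6⟩-star) and then receives at least 12, by a finite check over which of its faces are
-- triangles and which neighbours are big. A vertex of degree 12 to 17 sends at most 6 through each incident
-- triangle, since the two other corners cannot both be 5-vertices when one of them has it as only big
-- neighbour (a ⟨5,6,6,6,17⟩-star). A vertex of degree at least 18 sends at most 12 along an edge, and the
-- excess over 8 is shifted to a neighbouring edge whose head has degree 6 and which receives nothing
-- (⟨5,6,6,5,∞⟩-stars guarantee such an edge), so it sends at most 8 per edge on average.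

open import Defs
open import Data.Nat using (ℕ; zero; suc; _+_; _*_; _∸_; _≤_; _<_; z≤n; s≤s; _%_; _/_; _≤ᵇ_; _≡ᵇ_)
open import Data.Nat.Properties
open import Data.Fin using (Fin; zero; suc; toℕ; fromℕ<)
open import Data.Fin.Properties using (toℕ<n; toℕ-fromℕ<; toℕ-injective; pigeonhole; any?)
  renaming (_≟_ to _≟ᶠ_; suc-injective to suc-injectiveᶠ)
open import Data.Fin.Permutation using (permutation)
open import Data.Fin.Patterns using (0F; 1F; 2F; 3F; 4F)
open import Data.Nat.DivMod using (m≡m%n+[m/n]*n; m%n<n)
open import Relation.Binary.Definitions using (tri<; tri≈; tri>)
open import Data.Nat.Tactic.RingSolver using (solve-∀)
open import Data.List using (length; filter; tabulate)
open import Data.Maybe using (just; nothing)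
open import Data.Product using (Σ; _×_; _,_; proj₁; proj₂)
open import Data.Sum using (_⊎_; inj₁; inj₂; [_,_]′)
open import Data.Empty using (⊥; ⊥-elim)
open import Function using (_∘_; id)
open import Relation.Nullary using (¬_; Dec; yes; no; does; ¬?)
open import Relation.Nullary.Decidable using (_×-dec_; _⊎-dec_)
open import Data.Bool using (Bool; true; false; not; _∧_; _∨_; T)
open import Data.Bool.Properties using (T-∧; T-∨)
open import Data.Vec using (Vec; []; _∷_)
open import Data.Unit using (tt)
open import Function.Bundles using (Equivalence)
open import Relation.Binary.PropositionalEquality
  using (_≡_; _≢_; refl; sym; trans; cong; cong₂; subst; subst₂; module ≡-Reasoning)
open import Algebra.Properties.CommutativeMonoid.Sum +-0-commutativeMonoid
  using (sum; sum-syntax; sum-cong-≗; ∑-distrib-+; ∑-comm; sum-permute)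
open import Algebra.Properties.Semiring.Sum +-*-semiring using (*-distribˡ-sum; *-distribʳ-sum)

𝟙ᵇ : Bool → ℕ
𝟙ᵇ true  = 1
𝟙ᵇ false = 0

𝟙 : {P : Set} → Dec P → ℕ
𝟙 (yes _) = 1
𝟙 (no _)  = 0

𝟙≡𝟙ᵇ : {P : Set} (p : Dec P) → 𝟙 p ≡ 𝟙ᵇ (does p)
𝟙≡𝟙ᵇ (yes _) = refl
𝟙≡𝟙ᵇ (no _)  = refl

𝟙≤1 : {P : Set} (p : Dec P) → 𝟙 p ≤ 1
𝟙≤1 (yes _) = ≤-refl
𝟙≤1 (no _)  = z≤n

𝟙-yes : {P : Set} (p : Dec P) → P → 𝟙 p ≡ 1
𝟙-yes (yes _) _  = refl
𝟙-yes (no ¬p) p  = ⊥-elim (¬p p)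

𝟙-no : {P : Set} (p : Dec P) → ¬ P → 𝟙 p ≡ 0
𝟙-no (yes p) ¬p = ⊥-elim (¬p p)
𝟙-no (no _)  _  = refl

𝟙≡0⇒¬ : {P : Set} (p : Dec P) → 𝟙 p ≡ 0 → ¬ P
𝟙≡0⇒¬ (no ¬p) _ = ¬p

𝟙-cong : {P Q : Set} (p : Dec P) (q : Dec Q) → (P → Q) → (Q → P) → 𝟙 p ≡ 𝟙 q
𝟙-cong (yes _) (yes _) _ _ = refl
𝟙-cong (yes p) (no ¬q) f _ = ⊥-elim (¬q (f p))
𝟙-cong (no ¬p) (yes q) _ g = ⊥-elim (¬p (g q))
𝟙-cong (no _)  (no _)  _ _ = refl

𝟙-pos : {P : Set} (p : Dec P) → 0 < 𝟙 p → P
𝟙-pos (yes p) _ = p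

𝟙-split : {P Q : Set} (p : Dec P) (q : Dec Q) → 𝟙 (p ×-dec q) + 𝟙 (p ×-dec ¬? q) ≡ 𝟙 p
𝟙-split (yes _) (yes _) = refl
𝟙-split (yes _) (no _)  = refl
𝟙-split (no _)  _       = refl

sum-mono : ∀ {n} {f g : Fin n → ℕ} → (∀ i → f i ≤ g i) → sum f ≤ sum g
sum-mono {zero}  _   = z≤n
sum-mono {suc n} f≤g = +-mono-≤ (f≤g zero) (sum-mono (f≤g ∘ suc))

sum-const : ∀ n c → ∑[ i < n ] c ≡ n * c
sum-const zero    c = refl
sum-const (suc n) c = cong (c +_) (sum-const n c)

sum-zero : ∀ {n} (f : Fin n → ℕ) → (∀ i → f i ≡ 0) → sum f ≡ 0
sum-zero {n} f f≡0 = trans (sum-cong-≗ f≡0) (trans (sum-const n 0) (*-zeroʳ n))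

sum-single : ∀ {n} (f : Fin n → ℕ) a → (∀ i → i ≢ a → f i ≡ 0) → sum f ≡ f a
sum-single f zero    f≡0 = trans (cong (f zero +_) (sum-zero (f ∘ suc) (λ i → f≡0 (suc i) λ ()))) (+-identityʳ _)
sum-single f (suc a) f≡0 = trans (cong (_+ sum (f ∘ suc)) (f≡0 zero λ ()))
  (sum-single (f ∘ suc) a λ i i≢a → f≡0 (suc i) (i≢a ∘ suc-injectiveᶠ))

term≤sum : ∀ {n} (f : Fin n → ℕ) a → f a ≤ sum f
term≤sum f zero    = m≤m+n _ _
term≤sum f (suc a) = ≤-trans (term≤sum (f ∘ suc) a) (m≤n+m _ _)

sum≡0⇒term≡0 : ∀ {n} (f : Fin n → ℕ) → sum f ≡ 0 → ∀ a → f a ≡ 0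
sum≡0⇒term≡0 f sum≡0 a = n≤0⇒n≡0 (subst (f a ≤_) sum≡0 (term≤sum f a))

sum-δ : ∀ {n} a (h : Fin n → ℕ) → ∑[ e < n ] (𝟙 (a ≟ᶠ e) * h e) ≡ h a
sum-δ a h = trans (sum-single _ a λ e e≢a → cong (_* h e) (𝟙-no (a ≟ᶠ e) (e≢a ∘ sym)))
                  (trans (cong (_* h a) (𝟙-yes (a ≟ᶠ a) refl)) (+-identityʳ (h a)))

sum-reindex : ∀ {n} (f f⁻¹ : Fin n → Fin n) → (∀ x → f (f⁻¹ x) ≡ x) → (∀ x → f⁻¹ (f x) ≡ x) →
              ∀ h → ∑[ i < n ] h (f i) ≡ sum h
sum-reindex f f⁻¹ f∘f⁻¹ f⁻¹∘f h = sym (sum-permute h (permutation f f⁻¹ f∘f⁻¹ f⁻¹∘f))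

sum-snoc : ∀ p (a : ℕ → ℕ) → ∑[ k < suc p ] a (toℕ k) ≡ ∑[ k < p ] a (toℕ k) + a p
sum-snoc zero    a = +-comm (a 0) 0
sum-snoc (suc p) a = trans (cong (a 0 +_) (sum-snoc p (a ∘ suc))) (sym (+-assoc (a 0) _ _))

sum-rotate : ∀ p (a : ℕ → ℕ) → a p ≡ a 0 → ∑[ k < p ] a (suc (toℕ k)) ≡ ∑[ k < p ] a (toℕ k)
sum-rotate p a ap≡a0 = +-cancelˡ-≡ (a 0) _ _ (begin
  a 0 + ∑[ k < p ] a (suc (toℕ k)) ≡⟨ sum-snoc p a ⟩
  ∑[ k < p ] a (toℕ k) + a p       ≡⟨ cong (∑[ k < p ] a (toℕ k) +_) ap≡a0 ⟩
  ∑[ k < p ] a (toℕ k) + a 0       ≡⟨ +-comm _ (a 0) ⟩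
  a 0 + ∑[ k < p ] a (toℕ k)       ∎)
  where open ≡-Reasoning

count≡sum : ∀ {n} {P : Fin n → Set} (P? : ∀ i → Dec (P i)) → count n P? ≡ ∑[ i < n ] 𝟙 (P? i)
count≡sum {n} P? = go n id
  where
  go : ∀ m (f : Fin m → Fin n) → length (filter P? (tabulate f)) ≡ ∑[ i < m ] 𝟙 (P? (f i))
  go zero    f = refl
  go (suc m) f with P? (f zero)
  ... | yes _ = cong suc (go m (f ∘ suc))
  ... | no _  = go m (f ∘ suc)

least : {P : ℕ → Set} → (∀ k → Dec (P k)) → ∀ n → P n → Σ ℕ λ m → P m × m ≤ n × (∀ k → k < m → ¬ P k)
least P? zero p0 = 0 , p0 , z≤n , λ _ ()
least P? (suc n) pn with P? 0
... | yes p0 = 0 , p0 , z≤n , λ _ ()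
... | no ¬p0 with least (P? ∘ suc) n pn
...   | m , pm , m≤n , below = suc m , pm , s≤s m≤n , λ where
          zero    _          → ¬p0
          (suc k) (s≤s k<m) → below k k<m

least-fin : ∀ {n} {P : Fin n → Set} → (∀ i → Dec (P i)) → ∀ a → P a →
            Σ (Fin n) λ m → P m × (∀ i → P i → toℕ m ≤ toℕ i)
least-fin {suc n} P? a pa with P? zero
... | yes p0 = zero , p0 , λ _ _ → z≤n
least-fin P? zero    pa | no ¬p0 = ⊥-elim (¬p0 pa)
least-fin P? (suc a) pa | no ¬p0 with least-fin (P? ∘ suc) a pa
... | m , pm , min = suc m , pm , λ where
        zero    p → ⊥-elim (¬p0 p)
        (suc i) p → s≤s (min i p)

module Orbits (M : Map) (f f⁻¹ : Fin (Map.nd M) → Fin (Map.nd M))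
              (f∘f⁻¹ : ∀ x → f (f⁻¹ x) ≡ x) (f⁻¹∘f : ∀ x → f⁻¹ (f x) ≡ x) where
  open Map M using (nd)

  iter-+ : ∀ a b x → iter f (a + b) x ≡ iter f a (iter f b x)
  iter-+ zero    b x = refl
  iter-+ (suc a) b x = cong f (iter-+ a b x)

  iter-injective : ∀ k {x y} → iter f k x ≡ iter f k y → x ≡ y
  iter-injective zero    eq = eq
  iter-injective (suc k) eq = iter-injective k (trans (sym (f⁻¹∘f _)) (trans (cong f⁻¹ eq) (f⁻¹∘f _)))

  iter-cancel : ∀ i j x → i ≤ j → iter f i x ≡ iter f j x → iter f (j ∸ i) x ≡ x
  iter-cancel i j x i≤j eq = iter-injective i (begin
    iter f i (iter f (j ∸ i) x) ≡⟨ iter-+ i (j ∸ i) x ⟨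
    iter f (i + (j ∸ i)) x      ≡⟨ cong (λ n → iter f n x) (m+[n∸m]≡n i≤j) ⟩
    iter f j x                  ≡⟨ eq ⟨
    iter f i x                  ∎)
    where open ≡-Reasoning

  has-period : ∀ x → Σ ℕ λ p → 0 < p × p ≤ nd × iter f p x ≡ x
  has-period x with pigeonhole (n<1+n nd) (λ i → iter f (toℕ i) x)
  ... | i , j , i<j , eq = toℕ j ∸ toℕ i , m<n⇒0<n∸m i<j ,
    ≤-trans (m∸n≤m (toℕ j) (toℕ i)) (≤-pred (toℕ<n j)) , iter-cancel (toℕ i) (toℕ j) x (<⇒≤ i<j) eq

  opaque
    minimal-period : ∀ x → Σ ℕ λ m → suc m ≤ nd × iter f (suc m) x ≡ x × (∀ k → k < m → iter f (suc k) x ≢ x)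
    minimal-period x with has-period x
    ... | suc p , _ , p≤nd , fix with least (λ k → iter f (suc k) x ≟ᶠ x) p fix
    ...   | m , fix′ , m≤p , below = m , ≤-trans (s≤s m≤p) p≤nd , fix′ , below

  period : Fin nd → ℕ
  period x = suc (proj₁ (minimal-period x))

  iter-period : ∀ x → iter f (period x) x ≡ x
  iter-period x = proj₁ (proj₂ (proj₂ (minimal-period x)))

  period≤nd : ∀ x → period x ≤ nd
  period≤nd x = proj₁ (proj₂ (minimal-period x))

  period-minimal : ∀ x k → 0 < k → k < period x → iter f k x ≢ x
  period-minimal x (suc k) _ (s≤s k<m) = proj₂ (proj₂ (proj₂ (minimal-period x))) k k<m

  iter-period-* : ∀ x q → iter f (q * period x) x ≡ x
  iter-period-* x zero    = refl
  iter-period-* x (suc q) = trans (iter-+ (period x) (q * period x) x)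
    (trans (cong (iter f (period x)) (iter-period-* x q)) (iter-period x))

  iter-% : ∀ x k → iter f k x ≡ iter f (k % period x) x
  iter-% x k = begin
    iter f k x                                                     ≡⟨ cong (λ n → iter f n x) (m≡m%n+[m/n]*n k (period x)) ⟩
    iter f (k % period x + k / period x * period x) x              ≡⟨ iter-+ (k % period x) _ x ⟩
    iter f (k % period x) (iter f (k / period x * period x) x)     ≡⟨ cong (iter f (k % period x)) (iter-period-* x (k / period x)) ⟩
    iter f (k % period x) x                                        ∎
    where open ≡-Reasoning

  iter-injective-<period : ∀ x {i j} → i < period x → j < period x → iter f i x ≡ iter f j x → i ≡ j
  iter-injective-<period x {i} {j} i<p j<p eq with <-cmp i j
  ... | tri< i<j _ _ = ⊥-elim (period-minimal x (j ∸ i) (m<n⇒0<n∸m i<j) (≤-<-trans (m∸n≤m j i) j<p)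
                                               (iter-cancel i j x (<⇒≤ i<j) eq))
  ... | tri≈ _ i≡j _ = i≡j
  ... | tri> _ _ j<i = ⊥-elim (period-minimal x (i ∸ j) (m<n⇒0<n∸m j<i) (≤-<-trans (m∸n≤m i j) i<p)
                                               (iter-cancel j i x (<⇒≤ j<i) (sym eq)))

  _∼_ : Fin nd → Fin nd → Set
  _∼_ = SameOrbit M f

  ∼-intro : ∀ x k → x ∼ iter f k x
  ∼-intro x k = fromℕ< k%p<nd , trans (cong (λ n → iter f n x) (toℕ-fromℕ< k%p<nd)) (sym (iter-% x k))
    where k%p<nd = <-≤-trans (m%n<n k (period x)) (period≤nd x)

  ∼-elim : ∀ {x y} → x ∼ y → Σ ℕ λ k → k < period x × iter f k x ≡ y
  ∼-elim {x} (k , eq) = toℕ k % period x , m%n<n (toℕ k) (period x) , trans (sym (iter-% x (toℕ k))) eq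

  ∼-refl : ∀ x → x ∼ x
  ∼-refl x = ∼-intro x 0

  ∼-trans : ∀ {x y z} → x ∼ y → y ∼ z → x ∼ z
  ∼-trans {x} (a , refl) (b , refl) = subst (x ∼_) (iter-+ (toℕ b) (toℕ a) x) (∼-intro x (toℕ b + toℕ a))

  ∼-sym : ∀ {x y} → x ∼ y → y ∼ x
  ∼-sym {x} x∼y with ∼-elim x∼y
  ... | k , k<p , refl = subst (iter f k x ∼_) (begin
    iter f (period x ∸ k) (iter f k x) ≡⟨ iter-+ (period x ∸ k) k x ⟨
    iter f (period x ∸ k + k) x        ≡⟨ cong (λ n → iter f n x) (m∸n+n≡m (<⇒≤ k<p)) ⟩
    iter f (period x) x                ≡⟨ iter-period x ⟩
    x                                  ∎) (∼-intro (iter f k x) (period x ∸ k))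
    where open ≡-Reasoning

  orbit-indicator : ∀ x e → 𝟙 (sameOrbit? M f x e) ≡ ∑[ k < period x ] 𝟙 (iter f (toℕ k) x ≟ᶠ e)
  orbit-indicator x e with sameOrbit? M f x e
  ... | no x≁e = sym (sum-zero {period x} _ λ k →
    𝟙-no (iter f (toℕ k) x ≟ᶠ e) λ eq → x≁e (subst (x ∼_) eq (∼-intro x (toℕ k))))
  ... | yes x∼e with ∼-elim x∼e
  ...   | k₀ , k₀<p , refl = sym (trans (sum-single (λ k → 𝟙 (iter f (toℕ k) x ≟ᶠ iter f k₀ x)) k̂₀ off)
                                       (𝟙-yes (iter f (toℕ k̂₀) x ≟ᶠ _) (cong (λ n → iter f n x) (toℕ-fromℕ< k₀<p))))
    where
    k̂₀ = fromℕ< k₀<p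
    off : ∀ k → k ≢ k̂₀ → 𝟙 (iter f (toℕ k) x ≟ᶠ iter f k₀ x) ≡ 0
    off k k≢k̂₀ = 𝟙-no (iter f (toℕ k) x ≟ᶠ _) λ eq →
      k≢k̂₀ (toℕ-injective (trans (iter-injective-<period x (toℕ<n k) k₀<p eq) (sym (toℕ-fromℕ< k₀<p))))

  sum-over-orbit : ∀ x (h : Fin nd → ℕ) → ∑[ e < nd ] (𝟙 (sameOrbit? M f x e) * h e) ≡ ∑[ k < period x ] h (iter f (toℕ k) x)
  sum-over-orbit x h = begin
    ∑[ e < nd ] (𝟙 (sameOrbit? M f x e) * h e)
      ≡⟨ sum-cong-≗ {nd} (λ e → cong (_* h e) (orbit-indicator x e)) ⟩
    ∑[ e < nd ] (∑[ k < period x ] δ k e * h e)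
      ≡⟨ sum-cong-≗ {nd} (λ e → *-distribʳ-sum (h e) (λ k → δ k e)) ⟩
    ∑[ e < nd ] ∑[ k < period x ] (δ k e * h e)
      ≡⟨ ∑-comm (λ e k → δ k e * h e) ⟩
    ∑[ k < period x ] ∑[ e < nd ] (δ k e * h e)
      ≡⟨ sum-cong-≗ {period x} (λ k → sum-δ (iter f (toℕ k) x) h) ⟩
    ∑[ k < period x ] h (iter f (toℕ k) x)
      ∎
    where
    open ≡-Reasoning
    δ : Fin (period x) → Fin nd → ℕ
    δ k e = 𝟙 (iter f (toℕ k) x ≟ᶠ e)

  size : Fin nd → ℕ
  size x = count nd (sameOrbit? M f x)

  size≡period : ∀ x → size x ≡ period x
  size≡period x = begin
    count nd (sameOrbit? M f x)                  ≡⟨ count≡sum (sameOrbit? M f x) ⟩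
    ∑[ e < nd ] 𝟙 (sameOrbit? M f x e)           ≡⟨ sum-cong-≗ {nd} (λ e → *-identityʳ _) ⟨
    ∑[ e < nd ] (𝟙 (sameOrbit? M f x e) * 1)     ≡⟨ sum-over-orbit x (λ _ → 1) ⟩
    ∑[ k < period x ] 1                          ≡⟨ sum-const (period x) 1 ⟩
    period x * 1                                 ≡⟨ *-identityʳ (period x) ⟩
    period x                                     ∎
    where open ≡-Reasoning

  iter-size : ∀ x → iter f (size x) x ≡ x
  iter-size x = subst (λ n → iter f n x ≡ x) (sym (size≡period x)) (iter-period x)

  size-∼ : ∀ {x y} → x ∼ y → size x ≡ size y
  size-∼ {x} {y} x∼y = trans (count≡sum (sameOrbit? M f x)) (trans
    (sum-cong-≗ {nd} λ e → 𝟙-cong (sameOrbit? M f x e) (sameOrbit? M f y e) (∼-trans (∼-sym x∼y)) (∼-trans x∼y))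
    (sym (count≡sum (sameOrbit? M f y))))

  sum-over-orbit-∼ : ∀ {x y} → x ∼ y → (h : Fin nd → ℕ) →
    ∑[ e < nd ] (𝟙 (sameOrbit? M f x e) * h e) ≡ ∑[ e < nd ] (𝟙 (sameOrbit? M f y e) * h e)
  sum-over-orbit-∼ {x} {y} x∼y h = sum-cong-≗ {nd} λ e → cong (_* h e)
    (𝟙-cong (sameOrbit? M f x e) (sameOrbit? M f y e) (∼-trans (∼-sym x∼y)) (∼-trans x∼y))

  size-iter : ∀ k x → size (iter f k x) ≡ size x
  size-iter k x = sym (size-∼ (∼-intro x k))

  one-representative : ∀ e → ∑[ d < nd ] (𝟙 (orbitRep? M f d) * 𝟙 (sameOrbit? M f d e)) ≡ 1
  one-representative e with least-fin (sameOrbit? M f e) e (∼-refl e)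
  ... | m , e∼m , m-least = trans (sum-single _ m others) (at-m (orbitRep? M f m) (sameOrbit? M f m e))
    where
    m-rep : OrbitRep M f m
    m-rep y m∼y = m-least y (∼-trans e∼m m∼y)
    others : ∀ d → d ≢ m → 𝟙 (orbitRep? M f d) * 𝟙 (sameOrbit? M f d e) ≡ 0
    others d d≢m with orbitRep? M f d | sameOrbit? M f d e
    ... | yes d-rep | yes d∼e = ⊥-elim (d≢m (toℕ-injective (≤-antisym
            (d-rep m (∼-trans d∼e e∼m)) (m-rep d (∼-sym (∼-trans d∼e e∼m))))))
    ... | yes _ | no _ = refl
    ... | no _  | _    = refl
    at-m : (r : Dec (OrbitRep M f m)) (s : Dec (m ∼ e)) → 𝟙 r * 𝟙 s ≡ 1
    at-m (yes _) (yes _)  = refl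
    at-m (no ¬r) _        = ⊥-elim (¬r m-rep)
    at-m (yes _) (no m≁e) = ⊥-elim (m≁e (∼-sym e∼m))

  sum-by-orbits : ∀ (h : Fin nd → ℕ) →
    ∑[ d < nd ] (𝟙 (orbitRep? M f d) * ∑[ k < size d ] h (iter f (toℕ k) d)) ≡ sum h
  sum-by-orbits h = begin
    ∑[ d < nd ] (r d * ∑[ k < size d ] h (iter f (toℕ k) d))
      ≡⟨ sum-cong-≗ {nd} (λ d → cong (r d *_) (orbit d)) ⟩
    ∑[ d < nd ] (r d * ∑[ e < nd ] (o d e * h e))
      ≡⟨ sum-cong-≗ {nd} (λ d → *-distribˡ-sum (r d) (λ e → o d e * h e)) ⟩
    ∑[ d < nd ] ∑[ e < nd ] (r d * (o d e * h e))
      ≡⟨ ∑-comm (λ d e → r d * (o d e * h e)) ⟩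
    ∑[ e < nd ] ∑[ d < nd ] (r d * (o d e * h e))
      ≡⟨ sum-cong-≗ {nd} (λ e → sum-cong-≗ {nd} λ d → sym (*-assoc (r d) (o d e) (h e))) ⟩
    ∑[ e < nd ] ∑[ d < nd ] (r d * o d e * h e)
      ≡⟨ sum-cong-≗ {nd} (λ e → *-distribʳ-sum (h e) (λ d → r d * o d e)) ⟨
    ∑[ e < nd ] (∑[ d < nd ] (r d * o d e) * h e)
      ≡⟨ sum-cong-≗ {nd} (λ e → trans (cong (_* h e) (one-representative e)) (+-identityʳ (h e))) ⟩
    ∑[ e < nd ] h e
      ∎
    where
    open ≡-Reasoning
    r : Fin nd → ℕ
    r d = 𝟙 (orbitRep? M f d)
    o : Fin nd → Fin nd → ℕ
    o d e = 𝟙 (sameOrbit? M f d e)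
    orbit : ∀ d → ∑[ k < size d ] h (iter f (toℕ k) d) ≡ ∑[ e < nd ] (o d e * h e)
    orbit d = trans (cong (λ p → ∑[ k < p ] h (iter f (toℕ k) d)) (size≡period d)) (sym (sum-over-orbit d h))

  orbits-inequality : ∀ c (h h′ : Fin nd → ℕ) →
    (∀ d → c + ∑[ k < size d ] h (iter f (toℕ k) d) ≤ ∑[ k < size d ] h′ (iter f (toℕ k) d)) →
    c * numOrbits M f + sum h ≤ sum h′
  orbits-inequality c h h′ local = begin
    c * numOrbits M f + sum h                       ≡⟨ cong₂ _+_ (cong (c *_) (count≡sum (orbitRep? M f))) (sym (sum-by-orbits h)) ⟩
    c * sum r + ∑[ d < nd ] (r d * S h d)            ≡⟨ cong (_+ ∑[ d < nd ] (r d * S h d)) (*-distribˡ-sum c r) ⟩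
    ∑[ d < nd ] (c * r d) + ∑[ d < nd ] (r d * S h d) ≡⟨ ∑-distrib-+ (λ d → c * r d) (λ d → r d * S h d) ⟨
    ∑[ d < nd ] (c * r d + r d * S h d)              ≡⟨ sum-cong-≗ {nd} (λ d → cong (_+ r d * S h d) (*-comm c (r d))) ⟩
    ∑[ d < nd ] (r d * c + r d * S h d)              ≡⟨ sum-cong-≗ {nd} (λ d → *-distribˡ-+ (r d) c (S h d)) ⟨
    ∑[ d < nd ] (r d * (c + S h d))                  ≤⟨ sum-mono (λ d → *-monoʳ-≤ (r d) (local d)) ⟩
    ∑[ d < nd ] (r d * S h′ d)                       ≡⟨ sum-by-orbits h′ ⟩
    sum h′                                          ∎
    where
    open ≤-Reasoning
    r : Fin nd → ℕ
    r d = 𝟙 (orbitRep? M f d)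
    S : (Fin nd → ℕ) → Fin nd → ℕ
    S g d = ∑[ k < size d ] g (iter f (toℕ k) d)

charge-arithmetic : ∀ V F C n S Fs R → 72 * V + S ≤ n * 12 + R → 72 * F + Fs ≤ n * 24 →
                    S + Fs ≡ R → 2 * (V + F) ≡ n + 4 * C → C ≡ 0
charge-arithmetic V F C n S Fs R vertices faces conserved euler =
  n≤0⇒n≡0 (≤-trans (m≤n*m C 144) (+-cancelʳ-≤ (36 * n + R) (144 * C) 0 (begin
    144 * C + (36 * n + R)              ≡⟨ normalise₁ C n R ⟩
    36 * (n + 4 * C) + R                ≡⟨ cong₂ (λ a b → 36 * a + b) (sym euler) (sym conserved) ⟩
    36 * (2 * (V + F)) + (S + Fs)       ≡⟨ normalise₂ V F S Fs ⟩
    72 * V + S + (72 * F + Fs)          ≤⟨ +-mono-≤ vertices faces ⟩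
    n * 12 + R + n * 24                 ≡⟨ normalise₃ n R ⟩
    36 * n + R                          ∎)))
  where
  open ≤-Reasoning
  normalise₁ : ∀ C n R → 144 * C + (36 * n + R) ≡ 36 * (n + 4 * C) + R
  normalise₁ = solve-∀
  normalise₂ : ∀ V F S Fs → 36 * (2 * (V + F)) + (S + Fs) ≡ 72 * V + S + (72 * F + Fs)
  normalise₂ = solve-∀
  normalise₃ : ∀ n R → n * 12 + R + n * 24 ≡ 36 * n + R
  normalise₃ = solve-∀

numC-pos : ∀ M → 0 < Map.nd M → 1 ≤ numC M
numC-pos M pos = subst (1 ≤_) (sym (count≡sum (compRep? M)))
  (≤-trans (≤-reflexive (sym (𝟙-yes (compRep? M d₀) first))) (term≤sum (λ d → 𝟙 (compRep? M d)) d₀))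
  where
  d₀ = fromℕ< pos
  first : CompRep M d₀
  first e _ = subst (_≤ toℕ e) (sym (toℕ-fromℕ< pos)) z≤n

all-vectors : ∀ n → (Vec Bool n → Bool) → Bool
all-vectors zero    p = p []
all-vectors (suc n) p = all-vectors n (p ∘ (true ∷_)) ∧ all-vectors n (p ∘ (false ∷_))

all-vectors-sound : ∀ n p → T (all-vectors n p) → ∀ v → T (p v)
all-vectors-sound zero    p h []          = h
all-vectors-sound (suc n) p h (true ∷ v)  = all-vectors-sound n (p ∘ (true ∷_)) (proj₁ (Equivalence.to T-∧ h)) v
all-vectors-sound (suc n) p h (false ∷ v) = all-vectors-sound n (p ∘ (false ∷_)) (proj₂ (Equivalence.to T-∧ h)) v

demandᵇ : (big sole : Bool) → ℕ
demandᵇ false _     = 0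
demandᵇ true  false = 3
demandᵇ true  true  = 6

shareᵇ : (large large′ big sole : Bool) → ℕ
shareᵇ l l′ b s = 6 * 𝟙ᵇ l + 𝟙ᵇ (not l) * demandᵇ b s + 𝟙ᵇ (not l′) * demandᵇ b s

-- Around a 5-vertex: lᵢ says the face of the i-th dart is not a triangle (the i-th edge lies on the faces of
-- the i-th and (i+1)-st darts), bᵢ that the i-th neighbour is big.
five-vertex-ok : Vec Bool 10 → Bool
five-vertex-ok (l₀ ∷ l₁ ∷ l₂ ∷ l₃ ∷ l₄ ∷ b₀ ∷ b₁ ∷ b₂ ∷ b₃ ∷ b₄ ∷ []) = (bigs ≡ᵇ 0) ∨ (12 ≤ᵇ
    shareᵇ l₀ l₁ b₀ s + (shareᵇ l₁ l₂ b₁ s + (shareᵇ l₂ l₃ b₂ s + (shareᵇ l₃ l₄ b₃ s + (shareᵇ l₄ l₀ b₄ s + 0)))))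
  where
  bigs = 𝟙ᵇ b₀ + (𝟙ᵇ b₁ + (𝟙ᵇ b₂ + (𝟙ᵇ b₃ + (𝟙ᵇ b₄ + 0))))
  s = bigs ≡ᵇ 1

five-vertex-check : ∀ v → T (five-vertex-ok v)
five-vertex-check = all-vectors-sound 10 five-vertex-ok tt

UnavoidableStar : (M : Map) → Fin (Map.nd M) → Set
UnavoidableStar M d =
  Star M (just 5) (just 6) (just 6) (just 5) nothing d
  ⊎ (Star M (just 5) (just 6) (just 6) (just 6) (just 17) d
  ⊎ Star M (just 6) (just 6) (just 6) (just 6) (just 6) d)

module Discharging (M : Map) (simple : IsSimple M)
  (deg≥5 : ∀ d → 5 ≤ deg M d)
  (no-7-to-11 : ∀ d → ¬ (7 ≤ deg M d × deg M d ≤ 11))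
  (no-star : ∀ d → ¬ UnavoidableStar M d) where
  open Map M

  φ⁻¹ : Fin nd → Fin nd
  φ⁻¹ x = α (σ⁻¹ x)

  φ∘φ⁻¹ : ∀ x → φ M (φ⁻¹ x) ≡ x
  φ∘φ⁻¹ x = trans (cong σ (α-invol (σ⁻¹ x))) (σ-inv₁ x)

  φ⁻¹∘φ : ∀ x → φ⁻¹ (φ M x) ≡ x
  φ⁻¹∘φ x = trans (cong α (σ-inv₂ (α x))) (α-invol x)

  module V = Orbits M σ σ⁻¹ σ-inv₁ σ-inv₂
  module F = Orbits M (φ M) φ⁻¹ φ∘φ⁻¹ φ⁻¹∘φ

  -- opaque, so that unification never unfolds the orbit counts behind degrees and face sizes
  opaque
    dg : Fin nd → ℕ
    dg = V.size

    deg≡dg : ∀ x → deg M x ≡ dg x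
    deg≡dg x = refl

    fd : Fin nd → ℕ
    fd = F.size

    size≡fd : ∀ x → F.size x ≡ fd x
    size≡fd x = refl

  nb : Fin nd → ℕ → ℕ
  nb x i = dg (α (iter σ i x))

  dg-iter : ∀ k x → dg (iter σ k x) ≡ dg x
  dg-iter k x = trans (sym (deg≡dg _)) (trans (V.size-iter k x) (deg≡dg x))

  dg-σ : ∀ x → dg (σ x) ≡ dg x
  dg-σ = dg-iter 1

  dg-σ⁻¹ : ∀ x → dg (σ⁻¹ x) ≡ dg x
  dg-σ⁻¹ x = trans (sym (dg-σ (σ⁻¹ x))) (cong dg (σ-inv₁ x))

  fd-iter : ∀ k x → fd (iter (φ M) k x) ≡ fd x
  fd-iter k x = trans (sym (size≡fd _)) (trans (F.size-iter k x) (size≡fd x))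

  fd-φ⁻¹ : ∀ x → fd (φ⁻¹ x) ≡ fd x
  fd-φ⁻¹ x = trans (sym (fd-iter 1 (φ⁻¹ x))) (cong fd (φ∘φ⁻¹ x))

  fd-α : ∀ x → fd (α x) ≡ fd (σ x)
  fd-α x = trans (sym (fd-iter 1 (α x))) (cong (λ y → fd (σ y)) (α-invol x))

  dg≥5 : ∀ x → 5 ≤ dg x
  dg≥5 x = subst (5 ≤_) (deg≡dg x) (deg≥5 x)

  dg≤6⊎12≤dg : ∀ x → dg x ≤ 6 ⊎ 12 ≤ dg x
  dg≤6⊎12≤dg x with dg x ≤? 6 | 12 ≤? dg x
  ... | yes ≤6 | _      = inj₁ ≤6
  ... | no _   | yes ≥12 = inj₂ ≥12
  ... | no ≰6  | no ≱12  = ⊥-elim (no-7-to-11 x (subst (7 ≤_) (sym (deg≡dg x)) (≰⇒> ≰6) ,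
                                                 subst (_≤ 11) (sym (deg≡dg x)) (≤-pred (≰⇒> ≱12))))

  small : ∀ x → ¬ 12 ≤ dg x → dg x ≤ 6
  small x ≱12 with dg≤6⊎12≤dg x
  ... | inj₁ ≤6  = ≤6
  ... | inj₂ ≥12 = ⊥-elim (≱12 ≥12)

  period≡dg : ∀ x → V.period x ≡ dg x
  period≡dg x = trans (sym (V.size≡period x)) (deg≡dg x)

  σ-no-fix : ∀ x → σ x ≢ x
  σ-no-fix x σx≡x with V.period x in p≡
  ... | suc (suc _) = V.period-minimal x 1 (s≤s z≤n) (subst (1 <_) (sym p≡) (s≤s (s≤s z≤n))) σx≡x
  ... | 1 = <⇒≱ (s≤s (s≤s z≤n)) (subst (5 ≤_) (trans (sym (period≡dg x)) p≡) (dg≥5 x))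

  σ⁵ : ∀ x → dg x ≡ 5 → iter σ 5 x ≡ x
  σ⁵ x d5 = subst (λ p → iter σ p x ≡ x) (trans (period≡dg x) d5) (V.iter-period x)

  σ⁻¹≡σ⁴ : ∀ x → dg x ≡ 5 → σ⁻¹ x ≡ iter σ 4 x
  σ⁻¹≡σ⁴ x d5 = trans (cong σ⁻¹ (sym (σ⁵ x d5))) (σ-inv₂ (iter σ 4 x))

  nb-rotate : ∀ x → dg x ≡ 5 → ∀ k i → nb (iter σ k x) i ≡ nb x ((i + k) % 5)
  nb-rotate x d5 k i = cong (dg ∘ α) (begin
    iter σ i (iter σ k x)                    ≡⟨ V.iter-+ i k x ⟨
    iter σ (i + k) x                         ≡⟨ V.iter-% x (i + k) ⟩
    iter σ ((i + k) % V.period x) x          ≡⟨ cong (λ p → iter σ ((i + k) % suc p) x) (suc-injective (trans (period≡dg x) d5)) ⟩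
    iter σ ((i + k) % 5) x                   ∎)
    where open ≡-Reasoning

  face≥3 : ∀ x → 3 ≤ fd x
  face≥3 x = subst (3 ≤_) (trans (sym (F.size≡period x)) (size≡fd x)) (period≥3 (F.period x) refl)
    where
    open V using (_∼_)
    period≥3 : ∀ p → F.period x ≡ p → 3 ≤ p
    period≥3 (suc (suc (suc _))) _ = s≤s (s≤s (s≤s z≤n))
    period≥3 1 p≡1 = ⊥-elim (proj₁ simple x (V.∼-sym (subst (α x ∼_) φx≡x (V.∼-intro (α x) 1))))
      where
      φx≡x : σ (α x) ≡ x
      φx≡x = subst (λ p → iter (φ M) p x ≡ x) p≡1 (F.iter-period x)
    period≥3 2 p≡2 = ⊥-elim (σ-no-fix a (sym (proj₂ simple a (σ a) (V.∼-intro a 1) heads)))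
      where
      a = α x
      φ²x≡x : σ (α (σ a)) ≡ x
      φ²x≡x = subst (λ p → iter (φ M) p x ≡ x) p≡2 (F.iter-period x)
      heads : α a ∼ α (σ a)
      heads = subst (_∼ α (σ a)) (sym (α-invol x)) (V.∼-sym (subst (α (σ a) ∼_) φ²x≡x (V.∼-intro (α (σ a)) 1)))

  Large : Fin nd → Set
  Large x = 4 ≤ fd x

  large? : ∀ x → Dec (Large x)
  large? x = 4 ≤? fd x

  triangle : ∀ x → ¬ Large x → fd x ≡ 3
  triangle x small-face = ≤-antisym (≤-pred (≰⇒> small-face)) (face≥3 x)

  α∘φ-triangle : ∀ x → ¬ Large x → α (φ M x) ≡ σ⁻¹ (φ⁻¹ x)
  α∘φ-triangle x tri = begin
    α (φ M x)                    ≡⟨ σ-inv₂ _ ⟨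
    σ⁻¹ (φ M (φ M x))            ≡⟨ cong σ⁻¹ (trans (sym (φ⁻¹∘φ _)) (cong φ⁻¹ φ³x≡x)) ⟩
    σ⁻¹ (φ⁻¹ x)                  ∎
    where
    open ≡-Reasoning
    φ³x≡x : iter (φ M) 3 x ≡ x
    φ³x≡x = subst (λ p → iter (φ M) p x ≡ x) (trans (size≡fd x) (triangle x tri)) (F.iter-size x)

  -- For a triangular face with x from u to v and φ⁻¹ x from w to u: around v, w follows u; around w, v precedes u.
  nb-next-triangle : ∀ x → ¬ Large x → nb (α x) 1 ≡ dg (φ⁻¹ x)
  nb-next-triangle x tri = trans (cong dg (α∘φ-triangle x tri)) (dg-σ⁻¹ (φ⁻¹ x))

  nb-prev-triangle : ∀ x → ¬ Large x → dg (φ⁻¹ x) ≡ 5 → nb (φ⁻¹ x) 4 ≡ dg (α x)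
  nb-prev-triangle x tri d5 = begin
    dg (α (iter σ 4 (φ⁻¹ x)))    ≡⟨ cong (dg ∘ α) (σ⁻¹≡σ⁴ (φ⁻¹ x) d5) ⟨
    dg (α (σ⁻¹ (φ⁻¹ x)))         ≡⟨ cong (dg ∘ α) (α∘φ-triangle x tri) ⟨
    dg (α (α (φ M x)))           ≡⟨ cong dg (α-invol _) ⟩
    dg (σ (α x))                 ≡⟨ dg-σ (α x) ⟩
    dg (α x)                     ∎
    where open ≡-Reasoning

  ≤-rotate : ∀ {x} → dg x ≡ 5 → ∀ k i {b} → nb x ((i + k) % 5) ≤ b → nbdeg M (iter σ k x) i ≤ b
  ≤-rotate {x} d5 k i {b} = subst (_≤ b) (trans (sym (nb-rotate x d5 k i)) (sym (deg≡dg _)))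

  deg-rotate : ∀ {x} → dg x ≡ 5 → ∀ k → deg M (iter σ k x) ≡ 5
  deg-rotate {x} d5 k = trans (deg≡dg _) (trans (dg-iter k x) d5)

  no-⟨5,6,6,5,∞⟩ : ∀ x → dg x ≡ 5 → nb x 1 ≤ 5 → nb x 2 ≤ 6 → nb x 3 ≤ 6 → nb x 4 ≤ 5 → ⊥
  no-⟨5,6,6,5,∞⟩ x d5 n₁ n₂ n₃ n₄ = no-star (σ x) (inj₁ (deg-rotate d5 1 ,
    inj₁ (≤-rotate d5 1 0 n₁ , ≤-rotate d5 1 1 n₂ , ≤-rotate d5 1 2 n₃ , ≤-rotate d5 1 3 n₄ , _)))

  no-⟨5,6,6,6,17⟩ : ∀ x → dg x ≡ 5 → nb x 0 ≤ 17 → nb x 1 ≤ 5 → nb x 2 ≤ 6 → nb x 3 ≤ 6 → nb x 4 ≤ 6 → ⊥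
  no-⟨5,6,6,6,17⟩ x d5 n₀ n₁ n₂ n₃ n₄ = no-star (σ x) (inj₂ (inj₁ (deg-rotate d5 1 ,
    inj₁ (≤-rotate d5 1 0 n₁ , ≤-rotate d5 1 1 n₂ , ≤-rotate d5 1 2 n₃ , ≤-rotate d5 1 3 n₄ , ≤-rotate d5 1 4 n₀))))

  no-⟨5,6,6,6,17⟩-reversed : ∀ x → dg x ≡ 5 → nb x 0 ≤ 17 → nb x 4 ≤ 5 → nb x 3 ≤ 6 → nb x 2 ≤ 6 → nb x 1 ≤ 6 → ⊥
  no-⟨5,6,6,6,17⟩-reversed x d5 n₀ n₄ n₃ n₂ n₁ = no-star (iter σ 4 x) (inj₂ (inj₁ (deg-rotate d5 4 ,
    inj₂ (≤-rotate d5 4 0 n₄ , ≤-rotate d5 4 4 n₃ , ≤-rotate d5 4 3 n₂ , ≤-rotate d5 4 2 n₁ , ≤-rotate d5 4 1 n₀))))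

  no-⟨6,6,6,6,6⟩ : ∀ x → dg x ≡ 5 → nb x 0 ≤ 6 → nb x 1 ≤ 6 → nb x 2 ≤ 6 → nb x 3 ≤ 6 → nb x 4 ≤ 6 → ⊥
  no-⟨6,6,6,6,6⟩ x d5 n₀ n₁ n₂ n₃ n₄ = no-star x (inj₂ (inj₂ (deg-rotate d5 0 ,
    inj₁ (≤-rotate d5 0 0 n₀ , ≤-rotate d5 0 1 n₁ , ≤-rotate d5 0 2 n₂ , ≤-rotate d5 0 3 n₃ , ≤-rotate d5 0 4 n₄))))

  BigHead : Fin nd → Set
  BigHead x = 12 ≤ dg (α x)

  bigHead? : ∀ x → Dec (BigHead x)
  bigHead? x = 12 ≤? dg (α x)

  bigNbs : Fin nd → ℕ
  bigNbs x = ∑[ e < nd ] (𝟙 (sameOrbit? M σ x e) * 𝟙 (bigHead? e))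

  bigNbs-iter : ∀ k x → bigNbs (iter σ k x) ≡ bigNbs x
  bigNbs-iter k x = V.sum-over-orbit-∼ (V.∼-sym (V.∼-intro x k)) (𝟙 ∘ bigHead?)

  bigNbs-5 : ∀ x → dg x ≡ 5 → bigNbs x ≡ ∑[ i < 5 ] 𝟙 (bigHead? (iter σ (toℕ i) x))
  bigNbs-5 x d5 = trans (V.sum-over-orbit x (𝟙 ∘ bigHead?))
    (cong (λ p → ∑[ i < p ] 𝟙 (bigHead? (iter σ (toℕ i) x))) (trans (period≡dg x) d5))

  SoleBig : Fin nd → Set
  SoleBig x = dg x ≡ 5 × BigHead x × bigNbs x ≡ 1

  sole-big-others-small : ∀ x → SoleBig x → nb x 1 ≤ 6 × nb x 2 ≤ 6 × nb x 3 ≤ 6 × nb x 4 ≤ 6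
  sole-big-others-small x (d5 , big , one) = small-at 0F , small-at 1F , small-at 2F , small-at 3F
    where
    a : Fin 5 → ℕ
    a i = 𝟙 (bigHead? (iter σ (toℕ i) x))
    others : sum (a ∘ suc) ≡ 0
    others = +-cancelˡ-≡ 1 (sum (a ∘ suc)) 0
      (trans (cong (_+ sum (a ∘ suc)) (sym (𝟙-yes (bigHead? x) big))) (trans (sym (bigNbs-5 x d5)) one))
    small-at : ∀ (i : Fin 4) → nb x (suc (toℕ i)) ≤ 6
    small-at i = small _ (𝟙≡0⇒¬ (bigHead? _) (sum≡0⇒term≡0 (a ∘ suc) others i))

  demand : Fin nd → ℕ
  demand x = 𝟙 (dg x ≟ 5) * demandᵇ (does (bigHead? x)) (does (bigNbs x ≟ 1))

  DemandCases : Fin nd → Set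
  DemandCases x = demand x ≡ 0 ⊎ (demand x ≡ 3 × dg x ≡ 5 × BigHead x) ⊎ (demand x ≡ 6 × SoleBig x)

  demand-cases : ∀ x → DemandCases x
  demand-cases x = cases (dg x ≟ 5) (bigHead? x) (bigNbs x ≟ 1)
    where
    cases : ∀ {A B C : Set} (a : Dec A) (b : Dec B) (c : Dec C) → let d = 𝟙 a * demandᵇ (does b) (does c) in
            d ≡ 0 ⊎ (d ≡ 3 × A × B) ⊎ (d ≡ 6 × A × B × C)
    cases (no _)  _       _       = inj₁ refl
    cases (yes _) (no _)  _       = inj₁ refl
    cases (yes a) (yes b) (no _)  = inj₂ (inj₁ (refl , a , b))
    cases (yes a) (yes b) (yes c) = inj₂ (inj₂ (refl , a , b , c))

  demand≤6 : ∀ x → demand x ≤ 6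
  demand≤6 x with demand-cases x
  ... | inj₁ d≡0              = subst (_≤ 6) (sym d≡0) z≤n
  ... | inj₂ (inj₁ (d≡3 , _)) = subst (_≤ 6) (sym d≡3) (s≤s (s≤s (s≤s z≤n)))
  ... | inj₂ (inj₂ (d≡6 , _)) = subst (_≤ 6) (sym d≡6) ≤-refl

  demand-small-head : ∀ x → ¬ BigHead x → demand x ≡ 0
  demand-small-head x ¬big with demand-cases x
  ... | inj₁ d≡0                      = d≡0
  ... | inj₂ (inj₁ (_ , _ , big))     = ⊥-elim (¬big big)
  ... | inj₂ (inj₂ (_ , _ , big , _)) = ⊥-elim (¬big big)

  demand-not-5 : ∀ x → dg x ≢ 5 → demand x ≡ 0
  demand-not-5 x ≢5 with demand-cases x
  ... | inj₁ d≡0                 = d≡0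
  ... | inj₂ (inj₁ (_ , d5 , _)) = ⊥-elim (≢5 d5)
  ... | inj₂ (inj₂ (_ , d5 , _)) = ⊥-elim (≢5 d5)

  -- Charge moves along darts: received x is what the tail of x gets from the face of x and, through the
  -- triangles on both sides of x, from its head; sent x is what the tail of x gives to the two other corners
  -- of the face of x.
  faceShare triShare triShare′ received sent : Fin nd → ℕ
  faceShare x = 6 * 𝟙 (large? x)
  triShare  x = 𝟙 (¬? (large? x)) * demand x
  triShare′ x = 𝟙 (¬? (large? (α x))) * demand x
  received  x = faceShare x + triShare x + triShare′ x
  sent      x = triShare (φ⁻¹ x) + triShare′ (α x)

  conservation : sum sent + sum faceShare ≡ sum received
  conservation = begin
    sum sent + sum faceShare
      ≡⟨ cong (_+ sum faceShare) (∑-distrib-+ (triShare ∘ φ⁻¹) (triShare′ ∘ α)) ⟩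
    ∑[ x < nd ] triShare (φ⁻¹ x) + ∑[ x < nd ] triShare′ (α x) + sum faceShare
      ≡⟨ cong₂ (λ a b → a + b + sum faceShare) (sum-reindex φ⁻¹ (φ M) φ⁻¹∘φ φ∘φ⁻¹ triShare)
                                                (sum-reindex α α α-invol α-invol triShare′) ⟩
    sum triShare + sum triShare′ + sum faceShare                  ≡⟨ +-comm _ (sum faceShare) ⟩
    sum faceShare + (sum triShare + sum triShare′)                ≡⟨ +-assoc (sum faceShare) _ _ ⟨
    sum faceShare + sum triShare + sum triShare′                  ≡⟨ cong (_+ sum triShare′) (∑-distrib-+ faceShare triShare) ⟨
    ∑[ x < nd ] (faceShare x + triShare x) + sum triShare′        ≡⟨ ∑-distrib-+ (λ x → faceShare x + triShare x) triShare′ ⟨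
    sum received                                                  ∎
    where open ≡-Reasoning

  𝟙-triangle-cong : ∀ {x y} → fd x ≡ fd y → 𝟙 (¬? (large? x)) ≡ 𝟙 (¬? (large? y))
  𝟙-triangle-cong {x} {y} eq = 𝟙-cong (¬? (large? x)) (¬? (large? y))
    (λ ¬lx ly → ¬lx (subst (4 ≤_) (sym eq) ly)) (λ ¬ly lx → ¬ly (subst (4 ≤_) eq lx))

  sent-triangle : ∀ e → sent e ≡ 𝟙 (¬? (large? e)) * (demand (φ⁻¹ e) + demand (α e))
  sent-triangle e = trans
    (cong₂ _+_ (cong (_* demand (φ⁻¹ e)) (𝟙-triangle-cong (fd-φ⁻¹ e)))
               (cong (_* demand (α e)) (𝟙-triangle-cong (cong fd (α-invol e)))))
    (sym (*-distribˡ-+ (𝟙 (¬? (large? e))) (demand (φ⁻¹ e)) (demand (α e))))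

  nb-φ⁻¹-0 : ∀ e → nb (φ⁻¹ e) 0 ≡ dg e
  nb-φ⁻¹-0 e = trans (cong dg (α-invol (σ⁻¹ e))) (dg-σ⁻¹ e)

  nb-α-0 : ∀ e → nb (α e) 0 ≡ dg e
  nb-α-0 e = cong dg (α-invol e)

  sent-small-vertex : ∀ e → ¬ 12 ≤ dg e → sent e ≡ 0
  sent-small-vertex e ≱12 = trans (sent-triangle e) (trans
    (cong (𝟙 (¬? (large? e)) *_) (cong₂ _+_ (demand-small-head (φ⁻¹ e) (≱12 ∘ subst (12 ≤_) (nb-φ⁻¹-0 e)))
                                              (demand-small-head (α e) (≱12 ∘ subst (12 ≤_) (nb-α-0 e)))))
    (*-zeroʳ (𝟙 (¬? (large? e)))))

  sole-before-5 : ∀ e → ¬ Large e → dg e ≤ 17 → SoleBig (φ⁻¹ e) → dg (α e) ≢ 5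
  sole-before-5 e tri ≤17 sole@(d5 , _) v5 =
    let (n₁ , n₂ , n₃ , _) = sole-big-others-small (φ⁻¹ e) sole in
    no-⟨5,6,6,6,17⟩-reversed (φ⁻¹ e) d5 (subst (_≤ 17) (sym (nb-φ⁻¹-0 e)) ≤17)
      (≤-reflexive (trans (nb-prev-triangle e tri d5) v5)) n₃ n₂ n₁

  sole-after-5 : ∀ e → ¬ Large e → dg e ≤ 17 → SoleBig (α e) → dg (φ⁻¹ e) ≢ 5
  sole-after-5 e tri ≤17 sole@(d5 , _) w5 =
    let (_ , n₂ , n₃ , n₄) = sole-big-others-small (α e) sole in
    no-⟨5,6,6,6,17⟩ (α e) d5 (subst (_≤ 17) (sym (nb-α-0 e)) ≤17)
      (≤-reflexive (trans (nb-next-triangle e tri) w5)) n₂ n₃ n₄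

  demands≤6 : ∀ e → ¬ Large e → dg e ≤ 17 → demand (φ⁻¹ e) + demand (α e) ≤ 6
  demands≤6 e tri ≤17 with demand-cases (φ⁻¹ e) | demand-cases (α e)
  ... | inj₁ x≡0 | _ = subst (λ a → a + demand (α e) ≤ 6) (sym x≡0) (demand≤6 (α e))
  ... | _ | inj₁ y≡0 = subst (λ b → demand (φ⁻¹ e) + b ≤ 6) (sym y≡0)
                         (≤-trans (≤-reflexive (+-identityʳ _)) (demand≤6 (φ⁻¹ e)))
  ... | inj₂ (inj₁ (x≡3 , _)) | inj₂ (inj₁ (y≡3 , _)) = ≤-reflexive (cong₂ _+_ x≡3 y≡3)
  ... | inj₂ (inj₂ (_ , sole)) | inj₂ (inj₁ (_ , v5 , _)) = ⊥-elim (sole-before-5 e tri ≤17 sole v5)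
  ... | inj₂ (inj₂ (_ , sole)) | inj₂ (inj₂ (_ , v5 , _)) = ⊥-elim (sole-before-5 e tri ≤17 sole v5)
  ... | inj₂ (inj₁ (_ , w5 , _)) | inj₂ (inj₂ (_ , sole)) = ⊥-elim (sole-after-5 e tri ≤17 sole w5)

  sent≤6 : ∀ e → dg e ≤ 17 → sent e ≤ 6
  sent≤6 e ≤17 = subst (_≤ 6) (sym (sent-triangle e)) (bound (large? e))
    where
    bound : (l : Dec (Large e)) → 𝟙 (¬? l) * (demand (φ⁻¹ e) + demand (α e)) ≤ 6
    bound (yes _)  = z≤n
    bound (no tri) = ≤-trans (≤-reflexive (+-identityʳ _)) (demands≤6 e tri ≤17)

  around : Fin nd → (Fin nd → ℕ) → ℕ
  around d h = ∑[ k < dg d ] h (iter σ (toℕ k) d)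

  around-cong : ∀ d (h h′ : Fin nd → ℕ) → (∀ k → h (iter σ k d) ≡ h′ (iter σ k d)) → around d h ≡ around d h′
  around-cong d h h′ h≗h′ = sum-cong-≗ {dg d} (λ k → h≗h′ (toℕ k))

  around-σ : ∀ d h → around d (h ∘ σ) ≡ around d h
  around-σ d h = sum-rotate (dg d) (λ k → h (iter σ k d))
    (cong h (subst (λ n → iter σ n d ≡ d) (deg≡dg d) (V.iter-size d)))

  around-σ⁻¹ : ∀ d h → around d (h ∘ σ⁻¹) ≡ around d h
  around-σ⁻¹ d h = trans (sym (around-σ d (h ∘ σ⁻¹))) (around-cong d (h ∘ σ⁻¹ ∘ σ) h (λ k → cong h (σ-inv₂ _)))

  around-+ : ∀ d h h′ → around d (λ x → h x + h′ x) ≡ around d h + around d h′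
  around-+ d h h′ = ∑-distrib-+ {dg d} (λ k → h (iter σ (toℕ k) d)) (λ k → h′ (iter σ (toℕ k) d))

  around-* : ∀ d c h → around d (λ x → c * h x) ≡ c * around d h
  around-* d c h = sym (*-distribˡ-sum {dg d} c (λ k → h (iter σ (toℕ k) d)))

  around-const : ∀ d c → around d (λ _ → c) ≡ dg d * c
  around-const d c = sum-const (dg d) c

  around-mono : ∀ d (h h′ : Fin nd → ℕ) → (∀ k → h (iter σ k d) ≤ h′ (iter σ k d)) → around d h ≤ around d h′
  around-mono d h h′ h≤h′ = sum-mono {dg d} (λ k → h≤h′ (toℕ k))

  edgeShare : Fin nd → ℕ
  edgeShare e = triShare (α e) + triShare′ (α e)

  around-sent : ∀ d → around d sent ≡ around d edgeShare
  around-sent d = begin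
    around d sent                                 ≡⟨ around-+ d (triShare ∘ φ⁻¹) (triShare′ ∘ α) ⟩
    around d (triShare ∘ φ⁻¹) + T′                ≡⟨ cong (_+ T′) (around-σ d (triShare ∘ φ⁻¹)) ⟨
    around d (triShare ∘ φ⁻¹ ∘ σ) + T′            ≡⟨ cong (_+ T′) (around-cong d (triShare ∘ φ⁻¹ ∘ σ) (triShare ∘ α) λ k →
                                                                     cong (triShare ∘ α) (σ-inv₂ _)) ⟩
    around d (triShare ∘ α) + T′                  ≡⟨ around-+ d (triShare ∘ α) (triShare′ ∘ α) ⟨
    around d edgeShare                            ∎
    where
    open ≡-Reasoning
    T′ = around d (triShare′ ∘ α)

  edgeShare-triangles : ∀ e → edgeShare e ≡ (𝟙 (¬? (large? (σ e))) + 𝟙 (¬? (large? e))) * demand (α e)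
  edgeShare-triangles e = trans
    (cong₂ (λ a b → a * demand (α e) + b * demand (α e)) (𝟙-triangle-cong (fd-α e)) (𝟙-triangle-cong (cong fd (α-invol e))))
    (sym (*-distribʳ-+ (demand (α e)) (𝟙 (¬? (large? (σ e)))) (𝟙 (¬? (large? e)))))

  Heavy : Fin nd → Set
  Heavy e = SoleBig (α e) × ¬ Large e × ¬ Large (σ e)

  heavy? : ∀ e → Dec (Heavy e)
  heavy? e = (dg (α e) ≟ 5 ×-dec (bigHead? (α e) ×-dec bigNbs (α e) ≟ 1)) ×-dec (¬? (large? e) ×-dec ¬? (large? (σ e)))

  edgeShare-heavy : ∀ e → edgeShare e ≤ 8 + 4 * 𝟙 (heavy? e)
  edgeShare-heavy e = subst (_≤ bnd) (sym (edgeShare-triangles e)) (bound (demand-cases (α e)) (large? (σ e)) (large? e))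
    where
    bnd = 8 + 4 * 𝟙 (heavy? e)
    6≤bnd : 6 ≤ bnd
    6≤bnd = ≤-trans (s≤s (s≤s (s≤s (s≤s (s≤s (s≤s z≤n)))))) (m≤m+n 8 _)
    bound : DemandCases (α e) → (l₁ : Dec (Large (σ e))) (l₀ : Dec (Large e)) → (𝟙 (¬? l₁) + 𝟙 (¬? l₀)) * demand (α e) ≤ bnd
    bound (inj₁ d≡0) l₁ l₀ = subst (λ d → (𝟙 (¬? l₁) + 𝟙 (¬? l₀)) * d ≤ bnd) (sym d≡0)
      (≤-trans (≤-reflexive (*-zeroʳ (𝟙 (¬? l₁) + 𝟙 (¬? l₀)))) z≤n)
    bound (inj₂ (inj₁ (d≡3 , _))) l₁ l₀ = subst (λ d → (𝟙 (¬? l₁) + 𝟙 (¬? l₀)) * d ≤ bnd) (sym d≡3)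
      (≤-trans (*-monoˡ-≤ 3 (+-mono-≤ (𝟙≤1 (¬? l₁)) (𝟙≤1 (¬? l₀)))) 6≤bnd)
    bound (inj₂ (inj₂ (d≡6 , sole))) (no tri₁) (no tri₀) = subst (λ d → 2 * d ≤ bnd) (sym d≡6)
      (≤-reflexive (cong (λ h → 8 + 4 * h) (sym (𝟙-yes (heavy? e) (sole , tri₀ , tri₁)))))
    bound (inj₂ (inj₂ (d≡6 , _))) (yes _) (no _) = subst (λ d → 1 * d ≤ bnd) (sym d≡6) 6≤bnd
    bound (inj₂ (inj₂ (d≡6 , _))) (no _) (yes _) = subst (λ d → 1 * d ≤ bnd) (sym d≡6) 6≤bnd
    bound (inj₂ (inj₂ (_ , _))) (yes _) (yes _) = z≤n

  six? : ∀ e → Dec (dg (α (σ e)) ≡ 6)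
  six? e = dg (α (σ e)) ≟ 6

  -- a heavy edge passes its excess 4 to the next edge if that one ends in a 6-vertex, and to the previous one otherwise
  toNext toPrev : Fin nd → ℕ
  toNext e = 𝟙 (heavy? e ×-dec six? e)
  toPrev e = 𝟙 (heavy? e ×-dec ¬? (six? e))

  toPrev-six : ∀ e → 0 < toPrev (σ e) → dg (α e) ≡ 6
  toPrev-six e pos with 𝟙-pos (heavy? (σ e) ×-dec ¬? (six? (σ e))) pos
  ... | (sole@(z5 , _) , tri₁ , tri₂) , ≢6 =
    let (n₁ , n₂ , n₃ , n₄) = sole-big-others-small z sole in
    ≤-antisym (subst (_≤ 6) z₁ n₁) (≰⇒> λ ≤5 → no-⟨5,6,6,5,∞⟩ z z5 (subst (_≤ 5) (sym z₁) ≤5) n₂ n₃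
                                                 (≤-pred (≤∧≢⇒< n₄ (≢6 ∘ trans (sym z₄)))))
    where
    z = α (σ e)
    φ⁻¹σσe≡z : φ⁻¹ (σ (σ e)) ≡ z
    φ⁻¹σσe≡z = cong α (σ-inv₂ (σ e))
    z₁ : nb z 1 ≡ dg (α e)
    z₁ = trans (nb-next-triangle (σ e) tri₁) (cong (dg ∘ α) (σ-inv₂ e))
    z₄ : nb z 4 ≡ dg (α (σ (σ e)))
    z₄ = subst (λ w → nb w 4 ≡ dg (α (σ (σ e)))) φ⁻¹σσe≡z
           (nb-prev-triangle (σ (σ e)) tri₂ (subst (λ w → dg w ≡ 5) (sym φ⁻¹σσe≡z) z5))

  smoothing : ∀ e → edgeShare e + 4 * toNext (σ⁻¹ e) + 4 * toPrev (σ e) ≤ 8 + 4 * 𝟙 (heavy? e)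
  smoothing e with dg (α e) ≟ 6
  ... | yes six = begin
    edgeShare e + 4 * toNext (σ⁻¹ e) + 4 * toPrev (σ e) ≡⟨ cong (λ s → s + 4 * toNext (σ⁻¹ e) + 4 * toPrev (σ e)) no-share ⟩
    4 * toNext (σ⁻¹ e) + 4 * toPrev (σ e)               ≤⟨ +-mono-≤ (*-monoʳ-≤ 4 (𝟙≤1 (heavy? (σ⁻¹ e) ×-dec six? (σ⁻¹ e))))
                                                                     (*-monoʳ-≤ 4 (𝟙≤1 (heavy? (σ e) ×-dec ¬? (six? (σ e))))) ⟩
    8                                                   ≤⟨ m≤m+n 8 _ ⟩
    8 + 4 * 𝟙 (heavy? e)                                ∎
    where
    open ≤-Reasoning
    no-share : edgeShare e ≡ 0
    no-share = trans (edgeShare-triangles e) (trans (cong (triangles *_) (demand-not-5 (α e) λ five → 6≢5 (trans (sym six) five)))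
                                                    (*-zeroʳ triangles))
      where
      triangles = 𝟙 (¬? (large? (σ e))) + 𝟙 (¬? (large? e))
      6≢5 : 6 ≢ 5
      6≢5 ()
  ... | no ≢6 = begin
    edgeShare e + 4 * toNext (σ⁻¹ e) + 4 * toPrev (σ e) ≡⟨ cong₂ (λ a b → edgeShare e + 4 * a + 4 * b) no-next no-prev ⟩
    edgeShare e + 0 + 0                                 ≡⟨ trans (+-identityʳ _) (+-identityʳ _) ⟩
    edgeShare e                                         ≤⟨ edgeShare-heavy e ⟩
    8 + 4 * 𝟙 (heavy? e)                                ∎
    where
    open ≤-Reasoning
    no-next : toNext (σ⁻¹ e) ≡ 0
    no-next = n≤0⇒n≡0 (≮⇒≥ λ pos → ≢6 (subst (λ w → dg (α w) ≡ 6) (σ-inv₁ e)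
                (proj₂ (𝟙-pos (heavy? (σ⁻¹ e) ×-dec six? (σ⁻¹ e)) pos))))
    no-prev : toPrev (σ e) ≡ 0
    no-prev = n≤0⇒n≡0 (≮⇒≥ (≢6 ∘ toPrev-six e))

  around-sent≤ : ∀ d → around d sent ≤ dg d * 8
  around-sent≤ d = subst (_≤ dg d * 8) (sym (around-sent d)) (+-cancelʳ-≤ (4 * N + 4 * P) A (dg d * 8) (begin
    A + (4 * N + 4 * P)                                                       ≡⟨ +-assoc A (4 * N) (4 * P) ⟨
    A + 4 * N + 4 * P                                                         ≡⟨ lhs ⟨
    around d smoothed                                                         ≤⟨ around-mono d smoothed (λ e → 8 + 4 * 𝟙 (heavy? e)) (λ k → smoothing _) ⟩
    around d (λ e → 8 + 4 * 𝟙 (heavy? e))                                     ≡⟨ rhs ⟩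
    dg d * 8 + (4 * N + 4 * P)                                                ∎))
    where
    open ≤-Reasoning
    A = around d edgeShare
    N = around d toNext
    P = around d toPrev
    smoothed : Fin nd → ℕ
    smoothed e = edgeShare e + 4 * toNext (σ⁻¹ e) + 4 * toPrev (σ e)
    lhs : around d smoothed ≡ A + 4 * N + 4 * P
    lhs = trans (around-+ d (λ e → edgeShare e + 4 * toNext (σ⁻¹ e)) (λ e → 4 * toPrev (σ e)))
      (cong₂ _+_ (trans (around-+ d edgeShare (λ e → 4 * toNext (σ⁻¹ e)))
                        (cong (A +_) (trans (around-* d 4 (toNext ∘ σ⁻¹)) (cong (4 *_) (around-σ⁻¹ d toNext)))))
                 (trans (around-* d 4 (toPrev ∘ σ)) (cong (4 *_) (around-σ d toPrev))))
    rhs : around d (λ e → 8 + 4 * 𝟙 (heavy? e)) ≡ dg d * 8 + (4 * N + 4 * P)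
    rhs = trans (around-+ d (λ _ → 8) (λ e → 4 * 𝟙 (heavy? e)))
      (cong₂ _+_ (around-const d 8)
        (trans (around-* d 4 (𝟙 ∘ heavy?)) (trans (cong (4 *_) (trans
          (around-cong d (𝟙 ∘ heavy?) (λ e → toNext e + toPrev e) λ k → sym (𝟙-split (heavy? _) (six? _)))
          (around-+ d toNext toPrev))) (*-distribˡ-+ 4 N P))))

  received≡shareᵇ : ∀ x → dg x ≡ 5 →
    received x ≡ shareᵇ (does (large? x)) (does (large? (σ x))) (does (bigHead? x)) (does (bigNbs x ≟ 1))
  received≡shareᵇ x d5 = cong₂ _+_
    (cong₂ _+_ (cong (6 *_) (𝟙≡𝟙ᵇ (large? x))) (cong₂ _*_ (𝟙≡𝟙ᵇ (¬? (large? x))) demand≡))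
                                   (cong₂ _*_ (trans (𝟙-triangle-cong (fd-α x)) (𝟙≡𝟙ᵇ (¬? (large? (σ x))))) demand≡)
    where
    demand≡ : demand x ≡ demandᵇ (does (bigHead? x)) (does (bigNbs x ≟ 1))
    demand≡ = trans (cong (_* demandᵇ (does (bigHead? x)) (does (bigNbs x ≟ 1))) (𝟙-yes (dg x ≟ 5) d5)) (+-identityʳ _)

  some-big-neighbour : ∀ d → dg d ≡ 5 → bigNbs d ≢ 0
  some-big-neighbour d d5 none = no-⟨6,6,6,6,6⟩ d d5 (small-at 0F) (small-at 1F) (small-at 2F) (small-at 3F) (small-at 4F)
    where
    a : Fin 5 → ℕ
    a i = 𝟙 (bigHead? (iter σ (toℕ i) d))
    small-at : ∀ i → nb d (toℕ i) ≤ 6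
    small-at i = small _ (𝟙≡0⇒¬ (bigHead? _) (sum≡0⇒term≡0 a (trans (sym (bigNbs-5 d d5)) none) i))

  received-5-vertex : ∀ d → dg d ≡ 5 → 12 ≤ around d received
  received-5-vertex d d5 = [ (λ none → ⊥-elim (some-big-neighbour d d5 (trans bigNbs≡ (≡ᵇ⇒≡ bigs 0 none))))
                            , (λ enough → subst (12 ≤_) (sym total≡) (≤ᵇ⇒≤ 12 _ enough)) ]′
    (Equivalence.to T-∨ (five-vertex-check (L 0 ∷ L 1 ∷ L 2 ∷ L 3 ∷ L 4 ∷ B 0 ∷ B 1 ∷ B 2 ∷ B 3 ∷ B 4 ∷ [])))
    where
    e : ℕ → Fin nd
    e k = iter σ k d
    L B : ℕ → Bool
    L k = does (large? (e k))
    B k = does (bigHead? (e k))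
    bigs : ℕ
    bigs = 𝟙ᵇ (B 0) + (𝟙ᵇ (B 1) + (𝟙ᵇ (B 2) + (𝟙ᵇ (B 3) + (𝟙ᵇ (B 4) + 0))))
    bigNbs≡ : bigNbs d ≡ bigs
    bigNbs≡ = trans (bigNbs-5 d d5) (sum-cong-≗ {5} λ i → 𝟙≡𝟙ᵇ (bigHead? (e (toℕ i))))
    total : Bool → Bool → ℕ
    total l₅ s = shareᵇ (L 0) (L 1) (B 0) s + (shareᵇ (L 1) (L 2) (B 1) s + (shareᵇ (L 2) (L 3) (B 2) s
               + (shareᵇ (L 3) (L 4) (B 3) s + (shareᵇ (L 4) l₅ (B 4) s + 0))))
    total≡ : around d received ≡ total (L 0) (does (bigs ≟ 1))
    total≡ = begin
      around d received                                                   ≡⟨ cong (λ n → ∑[ k < n ] received (e (toℕ k))) d5 ⟩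
      ∑[ k < 5 ] received (e (toℕ k))
        ≡⟨ sum-cong-≗ {5} (λ k → received≡shareᵇ (e (toℕ k)) (trans (dg-iter (toℕ k) d) d5)) ⟩
      ∑[ k < 5 ] shareᵇ (L (toℕ k)) (L (suc (toℕ k))) (B (toℕ k)) (does (bigNbs (e (toℕ k)) ≟ 1))
        ≡⟨ sum-cong-≗ {5} (λ k → cong (λ n → shareᵇ (L (toℕ k)) (L (suc (toℕ k))) (B (toℕ k)) (does (n ≟ 1)))
                                      (trans (bigNbs-iter (toℕ k) d) bigNbs≡)) ⟩
      total (L 5) (does (bigs ≟ 1))
        ≡⟨ cong (λ l₅ → total l₅ (does (bigs ≟ 1))) (cong (does ∘ large?) (σ⁵ d d5)) ⟩
      total (L 0) (does (bigs ≟ 1))                                       ∎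
      where open ≡-Reasoning

  vertex-charge : ∀ d → 72 + around d sent ≤ around d (λ x → 12 + received x)
  vertex-charge d = subst (72 + around d sent ≤_)
    (sym (trans (around-+ d (λ _ → 12) received) (cong (_+ around d received) (around-const d 12))))
    (by-degree (dg≤6⊎12≤dg d) (dg d ≤? 17))
    where
    D = dg d
    surplus : ∀ a b → 72 ≤ D * a → 72 + D * b ≤ D * (a + b)
    surplus a b 72≤ = subst (72 + D * b ≤_) (sym (*-distribˡ-+ D a b)) (+-monoˡ-≤ (D * b) 72≤)
    by-degree : D ≤ 6 ⊎ 12 ≤ D → Dec (D ≤ 17) → 72 + around d sent ≤ D * 12 + around d received
    by-degree (inj₁ ≤6) _ = subst (λ s → 72 + s ≤ D * 12 + around d received) (sym nothing-sent) (five-or-six (m≤n⇒m<n∨m≡n ≤6))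
      where
      nothing-sent : around d sent ≡ 0
      nothing-sent = trans (around-cong d sent (λ _ → 0) λ k → sent-small-vertex _ λ ≥12 →
                             1+n≰n (≤-trans (≤-trans (m≤m+n 7 5) ≥12) (≤-trans (≤-reflexive (dg-iter k d)) ≤6)))
                           (trans (around-const d 0) (*-zeroʳ D))
      five-or-six : D < 6 ⊎ D ≡ 6 → 72 + 0 ≤ D * 12 + around d received
      five-or-six (inj₁ <6) = subst (λ n → 72 + 0 ≤ n * 12 + around d received) (sym d5) (+-monoʳ-≤ 60 (received-5-vertex d d5))
        where d5 = ≤-antisym (≤-pred <6) (dg≥5 d)
      five-or-six (inj₂ d6) = subst (λ n → 72 + 0 ≤ n * 12 + around d received) (sym d6) (m≤m+n 72 _)
    by-degree (inj₂ ≥12) (yes ≤17) = begin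
      72 + around d sent                  ≤⟨ +-monoʳ-≤ 72 (around-mono d sent (λ _ → 6) λ k →
                                               sent≤6 _ (≤-trans (≤-reflexive (dg-iter k d)) ≤17)) ⟩
      72 + around d (λ _ → 6)             ≡⟨ cong (72 +_) (around-const d 6) ⟩
      72 + D * 6                          ≤⟨ surplus 6 6 (*-monoˡ-≤ 6 ≥12) ⟩
      D * 12                              ≤⟨ m≤m+n _ _ ⟩
      D * 12 + around d received          ∎
      where open ≤-Reasoning
    by-degree (inj₂ _) (no ≰17) = begin
      72 + around d sent                  ≤⟨ +-monoʳ-≤ 72 (around-sent≤ d) ⟩
      72 + D * 8                          ≤⟨ surplus 4 8 (*-monoˡ-≤ 4 (≰⇒> ≰17)) ⟩
      D * 12                              ≤⟨ m≤m+n _ _ ⟩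
      D * 12 + around d received          ∎
      where open ≤-Reasoning

  face-charge : ∀ d → 72 + ∑[ k < fd d ] faceShare (iter (φ M) (toℕ k) d) ≤ ∑[ k < fd d ] 24
  face-charge d = subst₂ (λ s t → 72 + s ≤ t) (sym constant) (sym (sum-const (fd d) 24)) (by-size (large? d))
    where
    constant : ∑[ k < fd d ] faceShare (iter (φ M) (toℕ k) d) ≡ fd d * faceShare d
    constant = trans (sum-cong-≗ {fd d} λ k → cong (λ f → 6 * 𝟙 (4 ≤? f)) (fd-iter (toℕ k) d)) (sum-const (fd d) (faceShare d))
    by-size : (l : Dec (Large d)) → 72 + fd d * (6 * 𝟙 l) ≤ fd d * 24
    by-size (yes ≥4) = subst (72 + fd d * 6 ≤_) (sym (*-distribˡ-+ (fd d) 18 6)) (+-monoˡ-≤ (fd d * 6) (*-monoˡ-≤ 18 ≥4))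
    by-size (no tri) = subst (λ f → 72 + f * 0 ≤ f * 24) (sym (triangle d tri)) ≤-refl

  no-components : IsPlanar M → numC M ≡ 0
  no-components planar =
    charge-arithmetic (numV M) (numF M) (numC M) nd (sum sent) (sum faceShare) (sum received) vertices faces conservation planar
    where
    vertices : 72 * numV M + sum sent ≤ nd * 12 + sum received
    vertices = subst (72 * numV M + sum sent ≤_) (trans (∑-distrib-+ (λ _ → 12) received) (cong (_+ sum received) (sum-const nd 12)))
      (V.orbits-inequality 72 sent (λ x → 12 + received x) λ d →
        subst (λ n → 72 + ∑[ k < n ] sent (iter σ (toℕ k) d) ≤ ∑[ k < n ] (12 + received (iter σ (toℕ k) d)))
              (sym (deg≡dg d)) (vertex-charge d))
    faces : 72 * numF M + sum faceShare ≤ nd * 24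
    faces = subst (72 * numF M + sum faceShare ≤_) (sum-const nd 24)
      (F.orbits-inequality 72 faceShare (λ _ → 24) λ d →
        subst (λ n → 72 + ∑[ k < n ] faceShare (iter (φ M) (toℕ k) d) ≤ ∑[ k < n ] 24)
              (sym (size≡fd d)) (face-charge d))

≤κ? : ∀ M n k → Dec (_≤κ_ M n k)
≤κ? M n nothing  = yes tt
≤κ? M n (just k) = n ≤? k

star? : ∀ M κ₁ κ₂ κ₃ κ₄ κ₅ d → Dec (Star M κ₁ κ₂ κ₃ κ₄ κ₅ d)
star? M κ₁ κ₂ κ₃ κ₄ κ₅ d = deg M d ≟ 5 ×-dec
  ( (at 0 κ₁ ×-dec at 1 κ₂ ×-dec at 2 κ₃ ×-dec at 3 κ₄ ×-dec at 4 κ₅)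
  ⊎-dec (at 0 κ₁ ×-dec at 4 κ₂ ×-dec at 3 κ₃ ×-dec at 2 κ₄ ×-dec at 1 κ₅))
  where
  at : ∀ i κ → Dec (_≤κ_ M (nbdeg M d i) κ)
  at i = ≤κ? M (nbdeg M d i)

unavoidable? : ∀ M d → Dec (UnavoidableStar M d)
unavoidable? M d = star? M (just 5) (just 6) (just 6) (just 5) nothing d
  ⊎-dec star? M (just 5) (just 6) (just 6) (just 6) (just 17) d
  ⊎-dec star? M (just 6) (just 6) (just 6) (just 6) (just 6) d

theorem10 : (M : Map) → IsSimple M → IsPlanar M
    → 0 < Map.nd M
    → (∀ d → 5 ≤ deg M d)
    → (∀ d → ¬ (7 ≤ deg M d × deg M d ≤ 11))
    → Σ (Fin (Map.nd M)) λ d →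
        Star M (just 5) (just 6) (just 6) (just 5) nothing d
        ⊎ (Star M (just 5) (just 6) (just 6) (just 6) (just 17) d
        ⊎ Star M (just 6) (just 6) (just 6) (just 6) (just 6) d)
theorem10 M simple planar pos deg≥5 no-7-to-11 with any? (unavoidable? M)
... | yes found = found
... | no none = ⊥-elim (1+n≰n (subst (1 ≤_) no-components (numC-pos M pos)))
  where
  no-components : numC M ≡ 0
  no-components = Discharging.no-components M simple deg≥5 no-7-to-11 (λ d star → none (d , star)) planar
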